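{- Let $a\in\mathbb{YF}$ and $k\in\mathbb{N}_0$. Then $$d(2^k,a)=\sum_{1\le i_1<i_2<\dots<i_{d(a)-k}\le d(a)}\ \prod_{j=1}^{d(a)-k}\bigl(g'(a,i_j)+2j-2\bigr),$$ where $g'(a,t)=g(a,t)-2t+2$ (in particular, when $d(a)<k$ the sum is empty and equals $0$).
   Context: Words are finite words over $\{1,2\}$; $|x|$ is the digit sum and $d(x)$ (single argument) the number of $2$'s of $x$; $2^k$ is the word of $k$ letters $2$. $\mathbb{YF}$ is the set of all finite words. A word $y$ covers $x$ if $y$ is obtained from $x$ by replacing the leftmost $1$ of $x$ by $2$, or by inserting a $1$ somewhere to the left of the leftmost $1$ of $x$ (anywhere if $x$ has no $1$). $d(x,y)$ (two arguments) is the number of sequences $y=y_0,\dots,y_r=x$, $r=|y|-|x|\ge0$, with $y_j$ covering $y_{j+1}$ for all $j$ ($d(x,y)=0$ if no such sequence). For $1\le t\le d(x)$, $g(x,t)=1+$ (digit sum of the part of $x$ strictly to the right of the $t$-th $2$ of $x$, counting from the right). When $d(a)=k$ the sum has a single term, the empty product $1$. -}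

module Defs where

open import Data.Nat using (ℕ; zero; suc; _+_; _*_; _∸_; _≤_; _<_)
open import Data.Nat.ListAction using (sum)
open import Data.List using (List; []; _∷_; map; reverse; replicate; concatMap; length)
open import Relation.Nullary using (yes; no)
open import Relation.Binary.PropositionalEquality using (_≡_; refl)
open import Relation.Binary.Definitions using (DecidableEquality)
import Data.List.Properties as LP

data Digit : Set where
  one two : Digit

_≟D_ : DecidableEquality Digit
one ≟D one = yes refl
two ≟D two = yes refl
one ≟D two = no λ ()
two ≟D one = no λ ()

-- Words over {1,2}, written left to right (head = leftmost letter).
Word : Set
Word = List Digit

_≟W_ : DecidableEquality Word
_≟W_ = LP.≡-dec _≟D_

val : Digit → ℕ
val one = 1
val two = 2

∣_∣ : Word → ℕ
∣ x ∣ = sum (map val x)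

-- d(x) : number of 2's
twos : Word → ℕ
twos [] = 0
twos (one ∷ w) = twos w
twos (two ∷ w) = suc (twos w)

2^ : ℕ → Word
2^ k = replicate k two

-- The list of all words covering x (each exactly once):
-- replace the leftmost 1 by 2, or insert a 1 left of the leftmost 1
-- (anywhere if x has no 1).
covers : Word → List Word
covers [] = (one ∷ []) ∷ []
covers (one ∷ w) = (two ∷ w) ∷ (one ∷ one ∷ w) ∷ []
covers (two ∷ w) = (one ∷ two ∷ w) ∷ map (two ∷_) (covers w)

chains : ℕ → Word → Word → ℕ
chains zero x y with x ≟W y
... | yes _ = 1
... | no _ = 0
chains (suc r) x y = sum (map (λ z → chains r z y) (covers x))

-- d(x,y): number of sequences y = y_0, ..., y_r = x, r = |y| - |x|,
-- with y_j covering y_{j+1}  (0 when |y| < |x|, since then no chain exists)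
dd : Word → Word → ℕ
dd x y with ∣ y ∣ Data.Nat.<? ∣ x ∣
... | yes _ = 0
... | no _ = chains (∣ y ∣ ∸ ∣ x ∣) x y

-- given a reversed word (read right to left), the letters before the t-th 2
-- (t ≥ 1), i.e. the part of the original word strictly right of its t-th 2
-- counted from the right.
beforeNthTwo : ℕ → List Digit → List Digit
beforeNthTwo t [] = []
beforeNthTwo t (one ∷ w) = one ∷ beforeNthTwo t w
beforeNthTwo zero (two ∷ w) = []
beforeNthTwo (suc zero) (two ∷ w) = []
beforeNthTwo (suc (suc t)) (two ∷ w) = two ∷ beforeNthTwo (suc t) w

g : Word → ℕ → ℕ
g x t = 1 + ∣ beforeNthTwo t (reverse x) ∣

-- g'(x,t) = g(x,t) - 2t + 2  (always ≥ 1 for 1 ≤ t ≤ d(x), so truncated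
-- subtraction is exact)
g' : Word → ℕ → ℕ
g' x t = (g x t + 2) ∸ (2 * t)

incSeqsFrom : ℕ → ℕ → ℕ → List (List ℕ)
incSeqsFrom lo n zero = [] ∷ []
incSeqsFrom lo zero (suc m) = []
incSeqsFrom lo (suc n) (suc m) =
  map (lo ∷_) (incSeqsFrom (suc lo) n m) Data.List.++ incSeqsFrom (suc lo) n (suc m)

incSeqs : ℕ → ℕ → List (List ℕ)
incSeqs n m = incSeqsFrom 1 n m

termFrom : Word → ℕ → List ℕ → ℕ
termFrom a j [] = 1
termFrom a j (i ∷ is) = ((g' a i + 2 * j) ∸ 2) * termFrom a (suc j) is

rhs : Word → ℕ → ℕ
rhs a m = sum (map (termFrom a 1) (incSeqs (twos a) m))

-- Write c_k(a) for the number of saturated chains from 2^k up to a.  Since 2w covers exactly 1w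
-- and the words 2u with u covered by w, induction on the chain length read from the top gives
--   c_k(1w) = c_k(w),   c_k(2w) = c_{k−1}(w) + (|w| + 1 − 2k) · c_k(w)   (c_{−1} = 0).
-- The right-hand side obeys the same recursion: the leftmost 2 of 2w is the 2 of largest index d(2w),
-- and splitting the increasing sequences on whether they end at it gives the recursion, because
-- g'(2w, d(2w)) + 2m − 2 = |w| + 1 − 2k when m + k = d(2w).

module Submission where

open import Defs
open import Data.Empty using (⊥-elim)
open import Data.List using (List; []; _∷_; [_]; map; reverse; _++_)
import Data.List.Properties as List
open import Data.List.Relation.Binary.Permutation.Propositional.Properties using (↭-reverse)
open import Data.Nat using (ℕ; zero; suc; _+_; _*_; _∸_; _≤_; _<_; z≤n; s≤s; z<s; _<?_)
open import Data.Nat.ListAction using (sum)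
open import Data.Nat.ListAction.Properties using (sum-++; sum-↭)
open import Data.Nat.Properties
open import Algebra.Properties.CommutativeSemigroup +-commutativeSemigroup using (interchange)
open import Data.Nat.Solver using (module +-*-Solver)
open import Data.Product using (_×_; _,_)
open import Function using (_∘_)
open import Relation.Nullary using (yes; no)
open import Relation.Binary.PropositionalEquality
  using (_≡_; _≢_; refl; sym; trans; cong; cong₂; module ≡-Reasoning)
open +-*-Solver using (solve; _:+_; _:*_; _:=_; con)
open ≡-Reasoning

module _ {A : Set} where

  sum-map-cong : {f h : A → ℕ} → (∀ x → f x ≡ h x) →
                 ∀ xs → sum (map f xs) ≡ sum (map h xs)
  sum-map-cong f≗h []       = refl
  sum-map-cong f≗h (x ∷ xs) = cong₂ _+_ (f≗h x) (sum-map-cong f≗h xs)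

  sum-map-zero : {f : A → ℕ} → (∀ x → f x ≡ 0) → ∀ xs → sum (map f xs) ≡ 0
  sum-map-zero f≗0 []       = refl
  sum-map-zero f≗0 (x ∷ xs) = cong₂ _+_ (f≗0 x) (sum-map-zero f≗0 xs)

  sum-map-+ : (f h : A → ℕ) → ∀ xs →
              sum (map (λ x → f x + h x) xs) ≡ sum (map f xs) + sum (map h xs)
  sum-map-+ f h []       = refl
  sum-map-+ f h (x ∷ xs) = trans (cong (f x + h x +_) (sum-map-+ f h xs))
                                 (interchange (f x) (h x) (sum (map f xs)) (sum (map h xs)))

  sum-map-* : (c : ℕ) (f : A → ℕ) → ∀ xs →
              sum (map (λ x → c * f x) xs) ≡ c * sum (map f xs)
  sum-map-* c f []       = sym (*-zeroʳ c)
  sum-map-* c f (x ∷ xs) = trans (cong (c * f x +_) (sum-map-* c f xs))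
                                 (sym (*-distribˡ-+ c (f x) (sum (map f xs))))

  sum-map-∘ : {B : Set} (f : B → ℕ) (h : A → B) → ∀ xs →
              sum (map f (map h xs)) ≡ sum (map (f ∘ h) xs)
  sum-map-∘ f h xs = cong sum (sym (List.map-∘ xs))

  sum-map-reverse : (f : A → ℕ) → ∀ xs → sum (map f (reverse xs)) ≡ sum (map f xs)
  sum-map-reverse f xs = trans (cong sum (List.reverse-map f xs)) (sum-↭ (↭-reverse (map f xs)))

sum-comm : {A B : Set} (f : A → B → ℕ) (xs : List A) (ys : List B) →
           sum (map (λ x → sum (map (f x) ys)) xs)
             ≡ sum (map (λ y → sum (map (λ x → f x y) xs)) ys)
sum-comm f []       ys = sym (sum-map-zero (λ _ → refl) ys)
sum-comm f (x ∷ xs) ys = trans (cong (sum (map (f x) ys) +_) (sum-comm f xs ys))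
                               (sym (sum-map-+ (f x) (λ y → sum (map (λ x → f x y) xs)) ys))

δ : Word → Word → ℕ
δ = chains 0

δ-≢ : ∀ x y → x ≢ y → δ x y ≡ 0
δ-≢ x y x≢y with x ≟W y
... | yes x≡y = ⊥-elim (x≢y x≡y)
... | no _    = refl

δ-∷ : ∀ d x y → δ (d ∷ x) (d ∷ y) ≡ δ x y
δ-∷ d x y with x ≟W y | (d ∷ x) ≟W (d ∷ y)
... | yes _    | yes _     = refl
... | yes refl | no dx≢dy  = ⊥-elim (dx≢dy refl)
... | no x≢y   | yes dx≡dy = ⊥-elim (x≢y (List.∷-injectiveʳ dx≡dy))
... | no _     | no _      = refl

coveredBy : Word → List Word
coveredBy []        = []
coveredBy (one ∷ w) = [ w ]
coveredBy (two ∷ w) = (one ∷ w) ∷ map (two ∷_) (coveredBy w)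

module _ {y : Word} where

  sum-δ-map-∷ˡ : ∀ d zs →
                 sum (map (λ z → δ z (d ∷ y)) (map (d ∷_) zs)) ≡ sum (map (λ z → δ z y) zs)
  sum-δ-map-∷ˡ d zs = trans (sum-map-∘ _ (d ∷_) zs) (sum-map-cong (λ z → δ-∷ d z y) zs)

  sum-δ-map-∷ʳ : ∀ d ys → sum (map (δ (d ∷ y)) (map (d ∷_) ys)) ≡ sum (map (δ y) ys)
  sum-δ-map-∷ʳ d ys = trans (sum-map-∘ _ (d ∷_) ys) (sum-map-cong (δ-∷ d y) ys)

  sum-δ-map-≢ˡ : ∀ zs → (∀ z → two ∷ z ≢ y) →
                 sum (map (λ z → δ z y) (map (two ∷_) zs)) ≡ 0
  sum-δ-map-≢ˡ zs z≢y =
    trans (sum-map-∘ _ (two ∷_) zs) (sum-map-zero (λ z → δ-≢ (two ∷ z) y (z≢y z)) zs)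

  sum-δ-map-≢ʳ : ∀ ys → (∀ u → y ≢ two ∷ u) →
                 sum (map (δ y) (map (two ∷_) ys)) ≡ 0
  sum-δ-map-≢ʳ ys y≢u =
    trans (sum-map-∘ _ (two ∷_) ys) (sum-map-zero (λ u → δ-≢ y (two ∷ u) (y≢u u)) ys)

-- Both sides are 1 if y covers x and 0 otherwise.
δ-covers-coveredBy : ∀ x y →
                     sum (map (λ z → δ z y) (covers x)) ≡ sum (map (δ x) (coveredBy y))
δ-covers-coveredBy [] [] = cong (_+ 0) (δ-≢ [ one ] [] λ ())
δ-covers-coveredBy [] (one ∷ v) = cong (_+ 0) (δ-∷ one [] v)
δ-covers-coveredBy [] (two ∷ v) =
  trans (cong (_+ 0) (δ-≢ [ one ] (two ∷ v) λ ()))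
        (sym (cong₂ _+_ (δ-≢ [] (one ∷ v) λ ()) (sum-δ-map-≢ʳ (coveredBy v) λ _ ())))
δ-covers-coveredBy (one ∷ w) [] =
  cong₂ _+_ (δ-≢ (two ∷ w) [] λ ()) (cong (_+ 0) (δ-≢ (one ∷ one ∷ w) [] λ ()))
δ-covers-coveredBy (one ∷ w) (one ∷ v) =
  cong₂ _+_ (δ-≢ (two ∷ w) (one ∷ v) λ ()) (cong (_+ 0) (δ-∷ one (one ∷ w) v))
δ-covers-coveredBy (one ∷ w) (two ∷ v) =
  trans (cong₂ _+_ (δ-∷ two w v) (cong (_+ 0) (δ-≢ (one ∷ one ∷ w) (two ∷ v) λ ())))
        (sym (cong₂ _+_ (δ-∷ one w v) (sum-δ-map-≢ʳ (coveredBy v) λ _ ())))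
δ-covers-coveredBy (two ∷ w) [] =
  cong₂ _+_ (δ-≢ (one ∷ two ∷ w) [] λ ()) (sum-δ-map-≢ˡ (covers w) λ _ ())
δ-covers-coveredBy (two ∷ w) (one ∷ v) =
  cong₂ _+_ (δ-∷ one (two ∷ w) v) (sum-δ-map-≢ˡ (covers w) λ _ ())
δ-covers-coveredBy (two ∷ w) (two ∷ v) =
  cong₂ _+_ (trans (δ-≢ (one ∷ two ∷ w) (two ∷ v) λ ()) (sym (δ-≢ (two ∷ w) (one ∷ v) λ ()))) (begin
    sum (map (λ z → δ z (two ∷ v)) (map (two ∷_) (covers w)))
      ≡⟨ sum-δ-map-∷ˡ two (covers w) ⟩
    sum (map (λ z → δ z v) (covers w))
      ≡⟨ δ-covers-coveredBy w v ⟩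
    sum (map (δ w) (coveredBy v))
      ≡⟨ sum-δ-map-∷ʳ two (coveredBy v) ⟨
    sum (map (δ (two ∷ w)) (map (two ∷_) (coveredBy v))) ∎)

-- The definition of chains peels covering steps off at the bottom; this peels them off at the top.
chains-suc-coveredBy : ∀ r x y → chains (suc r) x y ≡ sum (map (chains r x) (coveredBy y))
chains-suc-coveredBy zero    x y = δ-covers-coveredBy x y
chains-suc-coveredBy (suc r) x y = begin
  sum (map (λ z → chains (suc r) z y) (covers x))
    ≡⟨ sum-map-cong (λ z → chains-suc-coveredBy r z y) (covers x) ⟩
  sum (map (λ z → sum (map (chains r z) (coveredBy y))) (covers x))
    ≡⟨ sum-comm (λ z y′ → chains r z y′) (covers x) (coveredBy y) ⟩
  sum (map (chains (suc r) x) (coveredBy y)) ∎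

chains-suc-one : ∀ r x w → chains (suc r) x (one ∷ w) ≡ chains r x w
chains-suc-one r x w = trans (chains-suc-coveredBy r x (one ∷ w)) (+-identityʳ _)

chains-suc-two : ∀ r x w →
  chains (suc r) x (two ∷ w)
    ≡ chains r x (one ∷ w) + sum (map (λ u → chains r x (two ∷ u)) (coveredBy w))
chains-suc-two r x w = trans (chains-suc-coveredBy r x (two ∷ w))
                             (cong (chains r x (one ∷ w) +_) (sum-map-∘ _ (two ∷_) (coveredBy w)))

δ-2^-one : ∀ k w → δ (2^ k) (one ∷ w) ≡ 0
δ-2^-one zero    w = δ-≢ [] (one ∷ w) λ ()
δ-2^-one (suc k) w = δ-≢ (2^ (suc k)) (one ∷ w) λ ()

chainsFromPred : ℕ → ℕ → Word → ℕ
chainsFromPred zero    r w = 0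
chainsFromPred (suc k) r w = chains r (2^ k) w

chainsFromPred-suc : ∀ k r w →
                     chainsFromPred k (suc r) w ≡ sum (map (chainsFromPred k r) (coveredBy w))
chainsFromPred-suc zero    r w = sym (sum-map-zero (λ _ → refl) (coveredBy w))
chainsFromPred-suc (suc k) r w = chains-suc-coveredBy r (2^ k) w

δ-2^-two : ∀ k w → δ (2^ k) (two ∷ w) ≡ chainsFromPred k 0 w
δ-2^-two zero    w = δ-≢ [] (two ∷ w) λ ()
δ-2^-two (suc k) w = δ-∷ two (2^ k) w

chains-1-2^-two : ∀ k w → chains 1 (2^ k) (two ∷ w) ≡ chainsFromPred k 1 w
chains-1-2^-two k w = begin
  chains 1 (2^ k) (two ∷ w)
    ≡⟨ chains-suc-two 0 (2^ k) w ⟩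
  δ (2^ k) (one ∷ w) + sum (map (λ u → δ (2^ k) (two ∷ u)) (coveredBy w))
    ≡⟨ cong₂ _+_ (δ-2^-one k w) (sum-map-cong (δ-2^-two k) (coveredBy w)) ⟩
  sum (map (chainsFromPred k 0) (coveredBy w))
    ≡⟨ chainsFromPred-suc k 0 w ⟨
  chainsFromPred k 1 w ∎

chains-2+-2^-two : ∀ k s w →
  chains (2 + s) (2^ k) (two ∷ w) ≡ chainsFromPred k (2 + s) w + suc s * chains s (2^ k) w
chains-2+-2^-two k zero w = begin
  chains 2 (2^ k) (two ∷ w)
    ≡⟨ chains-suc-two 1 (2^ k) w ⟩
  chains 1 (2^ k) (one ∷ w) + sum (map (λ u → chains 1 (2^ k) (two ∷ u)) (coveredBy w))
    ≡⟨ cong₂ _+_ (chains-suc-one 0 (2^ k) w) (sum-map-cong (chains-1-2^-two k) (coveredBy w)) ⟩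
  δ (2^ k) w + sum (map (chainsFromPred k 1) (coveredBy w))
    ≡⟨ cong (δ (2^ k) w +_) (chainsFromPred-suc k 1 w) ⟨
  δ (2^ k) w + chainsFromPred k 2 w
    ≡⟨ +-comm (δ (2^ k) w) _ ⟩
  chainsFromPred k 2 w + δ (2^ k) w
    ≡⟨ cong (chainsFromPred k 2 w +_) (*-identityˡ (δ (2^ k) w)) ⟨
  chainsFromPred k 2 w + 1 * δ (2^ k) w ∎
chains-2+-2^-two k (suc s) w = begin
  chains (3 + s) (2^ k) (two ∷ w)
    ≡⟨ chains-suc-two (2 + s) (2^ k) w ⟩
  chains (2 + s) (2^ k) (one ∷ w) + sum (map (λ u → chains (2 + s) (2^ k) (two ∷ u)) ws)
    ≡⟨ cong₂ _+_ (chains-suc-one (suc s) (2^ k) w) (sum-map-cong (chains-2+-2^-two k s) ws) ⟩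
  c + sum (map (λ u → P (2 + s) u + suc s * chains s (2^ k) u) ws)
    ≡⟨ cong (c +_) (sum-map-+ (P (2 + s)) (λ u → suc s * chains s (2^ k) u) ws) ⟩
  c + (sum (map (P (2 + s)) ws) + sum (map (λ u → suc s * chains s (2^ k) u) ws))
    ≡⟨ cong (c +_) (cong₂ _+_ (sym (chainsFromPred-suc k (2 + s) w))
                              (trans (sum-map-* (suc s) (chains s (2^ k)) ws)
                                     (cong (suc s *_) (sym (chains-suc-coveredBy s (2^ k) w))))) ⟩
  c + (P (3 + s) w + suc s * c)
    ≡⟨ solve 3 (λ c p s → c :+ (p :+ (con 1 :+ s) :* c) := p :+ (con 2 :+ s) :* c)
             refl c (P (3 + s) w) s ⟩
  P (3 + s) w + (2 + s) * c ∎
  where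
  ws = coveredBy w
  P  = chainsFromPred k
  c  = chains (suc s) (2^ k) w

chainCount : ℕ → Word → ℕ
chainCount k       (one ∷ w) = chainCount k w
chainCount zero    []        = 1
chainCount (suc k) []        = 0
chainCount zero    (two ∷ w) = suc ∣ w ∣ * chainCount zero w
chainCount (suc k) (two ∷ w) = chainCount k w + (suc ∣ w ∣ ∸ 2 * suc k) * chainCount (suc k) w

chainCount-vanish : ∀ k a → twos a < k → chainCount k a ≡ 0
chainCount-vanish (suc k) []        _   = refl
chainCount-vanish k       (one ∷ w) d<k = chainCount-vanish k w d<k
chainCount-vanish (suc k) (two ∷ w) d<k = begin
  chainCount k w + (suc ∣ w ∣ ∸ 2 * suc k) * chainCount (suc k) w
    ≡⟨ cong₂ (λ x y → x + (suc ∣ w ∣ ∸ 2 * suc k) * y)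
             (chainCount-vanish k w (≤-pred d<k))
             (chainCount-vanish (suc k) w (m<n⇒m<1+n (≤-pred d<k))) ⟩
  (suc ∣ w ∣ ∸ 2 * suc k) * 0
    ≡⟨ *-zeroʳ (suc ∣ w ∣ ∸ 2 * suc k) ⟩
  0 ∎

twos-bound : ∀ w → 2 * twos w ≤ ∣ w ∣
twos-bound []        = z≤n
twos-bound (one ∷ w) = m≤n⇒m≤1+n (twos-bound w)
twos-bound (two ∷ w) = ≤-trans (≤-reflexive (*-suc 2 (twos w))) (+-monoʳ-≤ 2 (twos-bound w))

∣2^∣ : ∀ k → ∣ 2^ k ∣ ≡ 2 * k
∣2^∣ zero    = refl
∣2^∣ (suc k) = trans (cong (2 +_) (∣2^∣ k)) (sym (*-suc 2 k))

chainCount-short : ∀ k a → ∣ a ∣ < ∣ 2^ k ∣ → chainCount k a ≡ 0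
chainCount-short k a a<2^k = chainCount-vanish k a
  (*-cancelˡ-< 2 _ _ (≤-<-trans (twos-bound a) (≤-trans a<2^k (≤-reflexive (∣2^∣ k)))))

chainCount-coefficient : ∀ {k r n} → ∣ 2^ k ∣ + r ≡ n → suc n ∸ 2 * suc k ≡ r ∸ 1
chainCount-coefficient {k} {r} refl = begin
  suc (∣ 2^ k ∣ + r) ∸ 2 * suc k
    ≡⟨ cong₂ _∸_ (trans (sym (+-suc _ r)) (cong (_+ suc r) (∣2^∣ k)))
                 (trans (*-suc 2 k) (+-comm 2 (2 * k))) ⟩
  2 * k + suc r ∸ (2 * k + 2)
    ≡⟨ [m+n]∸[m+o]≡n∸o (2 * k) (suc r) 2 ⟩
  r ∸ 1 ∎

-- ∣ 2^ (suc k) ∣ reduces to 2 + ∣ 2^ k ∣, which is why the length is written ∣ 2^ k ∣ + r.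
chains-2^ : ∀ k a r → ∣ 2^ k ∣ + r ≡ ∣ a ∣ → chains r (2^ k) a ≡ chainCount k a
chains-2^ zero    []        zero    _ = refl
chains-2^ k       (one ∷ w) zero    e =
  trans (δ-2^-one k w) (sym (chainCount-short k w (≤-reflexive (trans (sym e) (+-identityʳ _)))))
chains-2^ k       (one ∷ w) (suc r) e =
  trans (chains-suc-one r (2^ k) w) (chains-2^ k w r (suc-injective (trans (sym (+-suc _ r)) e)))
chains-2^ zero    (two ∷ w) _       refl = begin
  chains (2 + ∣ w ∣) [] (two ∷ w)
    ≡⟨ chains-2+-2^-two zero (∣ w ∣) w ⟩
  suc ∣ w ∣ * chains (∣ w ∣) [] w
    ≡⟨ cong (suc ∣ w ∣ *_) (chains-2^ zero w (∣ w ∣) refl) ⟩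
  suc ∣ w ∣ * chainCount zero w ∎
chains-2^ (suc k) (two ∷ w) r       e = begin
  chains r (2^ (suc k)) (two ∷ w)
    ≡⟨ chains-2^-two r e′ ⟩
  chainCount k w + (r ∸ 1) * chainCount (suc k) w
    ≡⟨ cong (λ c → chainCount k w + c * chainCount (suc k) w) (chainCount-coefficient {k} e′) ⟨
  chainCount (suc k) (two ∷ w) ∎
  where
  e′ : ∣ 2^ k ∣ + r ≡ ∣ w ∣
  e′ = suc-injective (suc-injective e)

  chains-2^-two : ∀ r → ∣ 2^ k ∣ + r ≡ ∣ w ∣ →
    chains r (2^ (suc k)) (two ∷ w) ≡ chainCount k w + (r ∸ 1) * chainCount (suc k) w
  chains-2^-two zero e =
    trans (δ-∷ two (2^ k) w) (trans (chains-2^ k w 0 e) (sym (+-identityʳ _)))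
  chains-2^-two (suc zero) e =
    trans (chains-1-2^-two (suc k) w) (trans (chains-2^ k w 1 e) (sym (+-identityʳ _)))
  chains-2^-two (suc (suc s)) e = trans (chains-2+-2^-two (suc k) s w)
    (cong₂ (λ x y → x + suc s * y) (chains-2^ k w (2 + s) e) (chains-2^ (suc k) w s e″))
    where
    e″ : ∣ 2^ (suc k) ∣ + s ≡ ∣ w ∣
    e″ = trans (sym (trans (+-suc _ (suc s)) (cong suc (+-suc _ s)))) e

dd-2^ : ∀ k a → dd (2^ k) a ≡ chainCount k a
dd-2^ k a with ∣ a ∣ <? ∣ 2^ k ∣
... | yes a<2^k = sym (chainCount-short k a a<2^k)
... | no  a≮2^k = chains-2^ k a (∣ a ∣ ∸ ∣ 2^ k ∣) (m+[n∸m]≡n (≮⇒≥ a≮2^k))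

seqProduct : (ℕ → ℕ → ℕ) → ℕ → List ℕ → ℕ
seqProduct φ j []       = 1
seqProduct φ j (i ∷ is) = φ i j * seqProduct φ (suc j) is

incSeqSum : (ℕ → ℕ → ℕ) → ℕ → ℕ → ℕ → ℕ → ℕ
incSeqSum φ lo n j m = sum (map (seqProduct φ j) (incSeqsFrom lo n m))

incSeqSum-head : ∀ φ lo n j m →
  incSeqSum φ lo (suc n) j (suc m)
    ≡ φ lo j * incSeqSum φ (suc lo) n (suc j) m + incSeqSum φ (suc lo) n j (suc m)
incSeqSum-head φ lo n j m = begin
  sum (map (seqProduct φ j) (map (lo ∷_) withLo ++ withoutLo))
    ≡⟨ cong sum (List.map-++ (seqProduct φ j) (map (lo ∷_) withLo) withoutLo) ⟩
  sum (map (seqProduct φ j) (map (lo ∷_) withLo) ++ map (seqProduct φ j) withoutLo)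
    ≡⟨ sum-++ (map (seqProduct φ j) (map (lo ∷_) withLo)) _ ⟩
  sum (map (seqProduct φ j) (map (lo ∷_) withLo)) + incSeqSum φ (suc lo) n j (suc m)
    ≡⟨ cong (_+ incSeqSum φ (suc lo) n j (suc m))
            (trans (sum-map-∘ (seqProduct φ j) (lo ∷_) withLo)
                   (sum-map-* (φ lo j) (seqProduct φ (suc j)) withLo)) ⟩
  φ lo j * incSeqSum φ (suc lo) n (suc j) m + incSeqSum φ (suc lo) n j (suc m) ∎
  where
  withLo    = incSeqsFrom (suc lo) n m
  withoutLo = incSeqsFrom (suc lo) n (suc m)

incSeqSum-tooLong : ∀ φ lo n j m → n < m → incSeqSum φ lo n j m ≡ 0
incSeqSum-tooLong φ lo zero    j (suc m) _   = refl
incSeqSum-tooLong φ lo (suc n) j (suc m) n<m = begin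
  incSeqSum φ lo (suc n) j (suc m)
    ≡⟨ incSeqSum-head φ lo n j m ⟩
  φ lo j * incSeqSum φ (suc lo) n (suc j) m + incSeqSum φ (suc lo) n j (suc m)
    ≡⟨ cong₂ (λ x y → φ lo j * x + y)
             (incSeqSum-tooLong φ (suc lo) n (suc j) m (≤-pred n<m))
             (incSeqSum-tooLong φ (suc lo) n j (suc m) (m<n⇒m<1+n (≤-pred n<m))) ⟩
  φ lo j * 0 + 0
    ≡⟨ trans (+-identityʳ _) (*-zeroʳ (φ lo j)) ⟩
  0 ∎

-- Splits off the smallest index on both sides.
incSeqSum-last : ∀ φ lo n j m →
  incSeqSum φ lo (suc n) j (suc m)
    ≡ incSeqSum φ lo n j (suc m) + φ (lo + n) (j + m) * incSeqSum φ lo n j m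
incSeqSum-last φ lo zero j zero =
  trans (+-identityʳ _) (cong₂ (λ i j → φ i j * 1) (sym (+-identityʳ lo)) (sym (+-identityʳ j)))
incSeqSum-last φ lo zero j (suc m) = sym (*-zeroʳ (φ (lo + 0) (j + suc m)))
incSeqSum-last φ lo (suc n) j zero
  rewrite incSeqSum-head φ lo (suc n) j zero | incSeqSum-last φ (suc lo) n j zero
        | incSeqSum-head φ lo n j zero | +-suc lo n | +-identityʳ j =
  sym (+-assoc (φ lo j * 1) (incSeqSum φ (suc lo) n j 1) (φ (suc (lo + n)) j * 1))
incSeqSum-last φ lo (suc n) j (suc m)
  rewrite incSeqSum-head φ lo (suc n) j (suc m) | incSeqSum-last φ (suc lo) n (suc j) m
        | incSeqSum-last φ (suc lo) n j (suc m) | incSeqSum-head φ lo n j (suc m)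
        | incSeqSum-head φ lo n j m | +-suc lo n | +-suc j m =
  solve 6 (λ x A Φ B C D → x :* (A :+ Φ :* B) :+ (C :+ Φ :* D) := (x :* A :+ C) :+ Φ :* (x :* B :+ D))
    refl (φ lo j) (incSeqSum φ (suc lo) n (suc j) (suc m)) (φ (suc (lo + n)) (suc (j + m)))
    (incSeqSum φ (suc lo) n (suc j) m) (incSeqSum φ (suc lo) n j (suc (suc m)))
    (incSeqSum φ (suc lo) n j (suc m))

incSeqSum-cong : ∀ φ ψ lo n j m →
                 (∀ i → lo ≤ i → i < lo + n → ∀ j → φ i j ≡ ψ i j) →
                 incSeqSum φ lo n j m ≡ incSeqSum ψ lo n j m
incSeqSum-cong φ ψ lo n       j zero    _   = refl
incSeqSum-cong φ ψ lo zero    j (suc m) _   = refl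
incSeqSum-cong φ ψ lo (suc n) j (suc m) φ≗ψ = begin
  incSeqSum φ lo (suc n) j (suc m)
    ≡⟨ incSeqSum-head φ lo n j m ⟩
  φ lo j * incSeqSum φ (suc lo) n (suc j) m + incSeqSum φ (suc lo) n j (suc m)
    ≡⟨ cong₂ _+_ (cong₂ _*_ (φ≗ψ lo ≤-refl (m<m+n lo z<s) j)
                            (incSeqSum-cong φ ψ (suc lo) n (suc j) m φ≗ψ′))
                 (incSeqSum-cong φ ψ (suc lo) n j (suc m) φ≗ψ′) ⟩
  ψ lo j * incSeqSum ψ (suc lo) n (suc j) m + incSeqSum ψ (suc lo) n j (suc m)
    ≡⟨ incSeqSum-head ψ lo n j m ⟨
  incSeqSum ψ lo (suc n) j (suc m) ∎
  where
  φ≗ψ′ : ∀ i → suc lo ≤ i → i < suc lo + n → ∀ j → φ i j ≡ ψ i j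
  φ≗ψ′ i lo<i i<1+lo+n =
    φ≗ψ i (<⇒≤ lo<i) (≤-trans i<1+lo+n (≤-reflexive (sym (+-suc lo n))))

twos-++ : ∀ u v → twos (u ++ v) ≡ twos u + twos v
twos-++ []        v = refl
twos-++ (one ∷ u) v = twos-++ u v
twos-++ (two ∷ u) v = cong suc (twos-++ u v)

twos-reverse : ∀ w → twos (reverse w) ≡ twos w
twos-reverse []      = refl
twos-reverse (d ∷ w) = begin
  twos (reverse (d ∷ w))         ≡⟨ cong twos (List.unfold-reverse d w) ⟩
  twos (reverse w ++ [ d ])      ≡⟨ twos-++ (reverse w) [ d ] ⟩
  twos (reverse w) + twos [ d ]  ≡⟨ cong (_+ twos [ d ]) (twos-reverse w) ⟩
  twos w + twos [ d ]            ≡⟨ +-comm (twos w) _ ⟩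
  twos [ d ] + twos w            ≡⟨ twos-++ [ d ] w ⟨
  twos (d ∷ w)                   ∎

beforeNthTwo-++ : ∀ i u v → 1 ≤ i → i ≤ twos u → beforeNthTwo i (u ++ v) ≡ beforeNthTwo i u
beforeNthTwo-++ (suc i)       (one ∷ u) v 1≤i i≤d =
  cong (one ∷_) (beforeNthTwo-++ (suc i) u v 1≤i i≤d)
beforeNthTwo-++ (suc zero)    (two ∷ u) v _   _   = refl
beforeNthTwo-++ (suc (suc i)) (two ∷ u) v _   i≤d =
  cong (two ∷_) (beforeNthTwo-++ (suc i) u v z<s (≤-pred i≤d))

beforeNthTwo-++-two : ∀ u v → beforeNthTwo (suc (twos u)) (u ++ two ∷ v) ≡ u
beforeNthTwo-++-two []        v = refl
beforeNthTwo-++-two (one ∷ u) v = cong (one ∷_) (beforeNthTwo-++-two u v)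
beforeNthTwo-++-two (two ∷ u) v = cong (two ∷_) (beforeNthTwo-++-two u v)

g-∷ : ∀ d w i → 1 ≤ i → i ≤ twos w → g (d ∷ w) i ≡ g w i
g-∷ d w i 1≤i i≤d = cong (λ x → 1 + ∣ x ∣) (begin
  beforeNthTwo i (reverse (d ∷ w))
    ≡⟨ cong (beforeNthTwo i) (List.unfold-reverse d w) ⟩
  beforeNthTwo i (reverse w ++ [ d ])
    ≡⟨ beforeNthTwo-++ i (reverse w) [ d ] 1≤i (≤-trans i≤d (≤-reflexive (sym (twos-reverse w)))) ⟩
  beforeNthTwo i (reverse w) ∎)

g-leftmostTwo : ∀ w → g (two ∷ w) (suc (twos w)) ≡ suc ∣ w ∣
g-leftmostTwo w = cong suc (begin
  ∣ beforeNthTwo (suc (twos w)) (reverse (two ∷ w)) ∣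
    ≡⟨ cong₂ (λ u v → ∣ beforeNthTwo (suc u) v ∣)
             (sym (twos-reverse w)) (List.unfold-reverse two w) ⟩
  ∣ beforeNthTwo (suc (twos (reverse w))) (reverse w ++ [ two ]) ∣
    ≡⟨ cong ∣_∣ (beforeNthTwo-++-two (reverse w) []) ⟩
  ∣ reverse w ∣
    ≡⟨ sum-map-reverse val w ⟩
  ∣ w ∣ ∎)

-- The j-th factor g'(a,i) + 2j − 2 of the products in rhs; j ≥ 1 there, so the subtraction is exact.
factor : Word → ℕ → ℕ → ℕ
factor a i j = (g' a i + 2 * j) ∸ 2

termFrom≡seqProduct : ∀ a j is → termFrom a j is ≡ seqProduct (factor a) j is
termFrom≡seqProduct a j []       = refl
termFrom≡seqProduct a j (i ∷ is) = cong (factor a i j *_) (termFrom≡seqProduct a (suc j) is)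

rhs≡incSeqSum : ∀ a m → rhs a m ≡ incSeqSum (factor a) 1 (twos a) 1 m
rhs≡incSeqSum a m = sum-map-cong (termFrom≡seqProduct a 1) (incSeqs (twos a) m)

incSeqSum-factor-∷ : ∀ d w m →
                     incSeqSum (factor (d ∷ w)) 1 (twos w) 1 m ≡ incSeqSum (factor w) 1 (twos w) 1 m
incSeqSum-factor-∷ d w m = incSeqSum-cong _ _ 1 (twos w) 1 m λ i 1≤i i≤d j →
  cong (λ x → ((x + 2) ∸ 2 * i + 2 * j) ∸ 2) (g-∷ d w i 1≤i (≤-pred i≤d))

leftmostFactor-arith : ∀ {x n m k} → 2 * n ≤ x → m + k ≡ n →
                       ((suc x + 2) ∸ 2 * suc n + 2 * suc m) ∸ 2 ≡ suc x ∸ 2 * k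
leftmostFactor-arith {m = m} {k} 2n≤x refl with m≤n⇒∃[o]m+o≡n 2n≤x
... | y , refl = trans left (sym right)
  where
  left : ((suc (2 * (m + k) + y) + 2) ∸ 2 * suc (m + k) + 2 * suc m) ∸ 2 ≡ suc (y + 2 * m)
  left = begin
    ((suc (2 * (m + k) + y) + 2) ∸ 2 * suc (m + k) + 2 * suc m) ∸ 2
      ≡⟨ cong (λ z → (z ∸ 2 * suc (m + k) + 2 * suc m) ∸ 2)
              (solve 3 (λ m k y → con 1 :+ (con 2 :* (m :+ k) :+ y) :+ con 2
                                  := (con 1 :+ y) :+ con 2 :* (con 1 :+ (m :+ k))) refl m k y) ⟩
    (suc y + 2 * suc (m + k) ∸ 2 * suc (m + k) + 2 * suc m) ∸ 2
      ≡⟨ cong (λ z → (z + 2 * suc m) ∸ 2) (m+n∸n≡m (suc y) (2 * suc (m + k))) ⟩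
    (suc y + 2 * suc m) ∸ 2
      ≡⟨ cong (_∸ 2) (solve 2 (λ m y → (con 1 :+ y) :+ con 2 :* (con 1 :+ m)
                                       := (con 1 :+ (y :+ con 2 :* m)) :+ con 2) refl m y) ⟩
    (suc (y + 2 * m) + 2) ∸ 2
      ≡⟨ m+n∸n≡m (suc (y + 2 * m)) 2 ⟩
    suc (y + 2 * m) ∎
  right : suc (2 * (m + k) + y) ∸ 2 * k ≡ suc (y + 2 * m)
  right = trans (cong (_∸ 2 * k) (solve 3 (λ m k y → con 1 :+ (con 2 :* (m :+ k) :+ y)
                                                  := (con 1 :+ (y :+ con 2 :* m)) :+ con 2 :* k) refl m k y))
              (m+n∸n≡m (suc (y + 2 * m)) (2 * k))

factor-leftmostTwo : ∀ w {m k} → m + k ≡ twos w →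
                     factor (two ∷ w) (suc (twos w)) (suc m) ≡ suc ∣ w ∣ ∸ 2 * k
factor-leftmostTwo w {m} {k} m+k≡d = begin
  ((g (two ∷ w) (suc (twos w)) + 2) ∸ 2 * suc (twos w) + 2 * suc m) ∸ 2
    ≡⟨ cong (λ x → ((x + 2) ∸ 2 * suc (twos w) + 2 * suc m) ∸ 2) (g-leftmostTwo w) ⟩
  ((suc ∣ w ∣ + 2) ∸ 2 * suc (twos w) + 2 * suc m) ∸ 2
    ≡⟨ leftmostFactor-arith (twos-bound w) m+k≡d ⟩
  suc ∣ w ∣ ∸ 2 * k ∎

rhs-tooLong : ∀ a m → twos a < m → rhs a m ≡ 0
rhs-tooLong a m d<m = trans (rhs≡incSeqSum a m) (incSeqSum-tooLong (factor a) 1 (twos a) 1 m d<m)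

rhs-one : ∀ w m → rhs (one ∷ w) m ≡ rhs w m
rhs-one w m = begin
  rhs (one ∷ w) m                         ≡⟨ rhs≡incSeqSum (one ∷ w) m ⟩
  incSeqSum (factor (one ∷ w)) 1 d 1 m    ≡⟨ incSeqSum-factor-∷ one w m ⟩
  incSeqSum (factor w) 1 d 1 m            ≡⟨ rhs≡incSeqSum w m ⟨
  rhs w m                                 ∎
  where d = twos w

-- The leftmost 2 of 2w carries the largest index d(2w); split on whether the sequence ends there.
rhs-two : ∀ w {m k} → m + k ≡ twos w →
          rhs (two ∷ w) (suc m) ≡ rhs w (suc m) + (suc ∣ w ∣ ∸ 2 * k) * rhs w m
rhs-two w {m} {k} m+k≡d = begin
  rhs (two ∷ w) (suc m)
    ≡⟨ rhs≡incSeqSum (two ∷ w) (suc m) ⟩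
  incSeqSum φ 1 (suc d) 1 (suc m)
    ≡⟨ incSeqSum-last φ 1 d 1 m ⟩
  incSeqSum φ 1 d 1 (suc m) + φ (suc d) (suc m) * incSeqSum φ 1 d 1 m
    ≡⟨ cong₂ _+_ (incSeqSum-factor-∷ two w (suc m))
                 (cong₂ _*_ (factor-leftmostTwo w m+k≡d) (incSeqSum-factor-∷ two w m)) ⟩
  incSeqSum (factor w) 1 d 1 (suc m) + (suc ∣ w ∣ ∸ 2 * k) * incSeqSum (factor w) 1 d 1 m
    ≡⟨ cong₂ (λ x y → x + (suc ∣ w ∣ ∸ 2 * k) * y)
             (rhs≡incSeqSum w (suc m)) (rhs≡incSeqSum w m) ⟨
  rhs w (suc m) + (suc ∣ w ∣ ∸ 2 * k) * rhs w m ∎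
  where
  φ = factor (two ∷ w)
  d = twos w

chainCount≡rhs : ∀ a m k → m + k ≡ twos a → chainCount k a ≡ rhs a m
chainCount≡rhs []        zero    zero    _     = refl
chainCount≡rhs (one ∷ w) m       k       m+k≡d = trans (chainCount≡rhs w m k m+k≡d) (sym (rhs-one w m))
chainCount≡rhs (two ∷ w) zero    (suc k) m+k≡d = begin
  chainCount k w + (suc ∣ w ∣ ∸ 2 * suc k) * chainCount (suc k) w
    ≡⟨ cong₂ (λ x y → x + (suc ∣ w ∣ ∸ 2 * suc k) * y)
             (chainCount≡rhs w zero k k≡d)
             (chainCount-vanish (suc k) w (≤-reflexive (cong suc (sym k≡d)))) ⟩
  1 + (suc ∣ w ∣ ∸ 2 * suc k) * 0
    ≡⟨ cong suc (*-zeroʳ (suc ∣ w ∣ ∸ 2 * suc k)) ⟩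
  1 ∎
  where k≡d = suc-injective m+k≡d
chainCount≡rhs (two ∷ w) (suc m) zero    m+k≡d = begin
  suc ∣ w ∣ * chainCount zero w
    ≡⟨ cong (suc ∣ w ∣ *_) (chainCount≡rhs w m zero m≡d) ⟩
  suc ∣ w ∣ * rhs w m
    ≡⟨ cong (_+ suc ∣ w ∣ * rhs w m) (rhs-tooLong w (suc m) d<1+m) ⟨
  rhs w (suc m) + suc ∣ w ∣ * rhs w m
    ≡⟨ rhs-two w m≡d ⟨
  rhs (two ∷ w) (suc m) ∎
  where
  m≡d : m + 0 ≡ twos w
  m≡d = suc-injective m+k≡d
  d<1+m : twos w < suc m
  d<1+m = s≤s (≤-reflexive (trans (sym m≡d) (+-identityʳ m)))
chainCount≡rhs (two ∷ w) (suc m) (suc k) m+k≡d = begin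
  chainCount k w + (suc ∣ w ∣ ∸ 2 * suc k) * chainCount (suc k) w
    ≡⟨ cong₂ (λ x y → x + (suc ∣ w ∣ ∸ 2 * suc k) * y)
             (chainCount≡rhs w (suc m) k (trans (sym (+-suc m k)) m+k≡d′))
             (chainCount≡rhs w m (suc k) m+k≡d′) ⟩
  rhs w (suc m) + (suc ∣ w ∣ ∸ 2 * suc k) * rhs w m
    ≡⟨ rhs-two w m+k≡d′ ⟨
  rhs (two ∷ w) (suc m) ∎
  where m+k≡d′ = suc-injective m+k≡d

mainTheorem10 : (a : Word) (k : ℕ) →
    ((m : ℕ) → m + k ≡ twos a → dd (2^ k) a ≡ rhs a m) × (twos a < k → dd (2^ k) a ≡ 0)
mainTheorem10 a k =
  (λ m m+k≡d → trans (dd-2^ k a) (chainCount≡rhs a m k m+k≡d)) ,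
  (λ d<k → trans (dd-2^ k a) (chainCount-vanish k a d<k))
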